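{- Let $G$ be a graph and let $l$ be an intersecting supermodular real function on subsets of $V(G)$. Then $$\Theta_l(G)=\max\Big\{\sum_{A\in P}l(A)-e_G(P): P \text{ is a partition of } V(G)\Big\}.$$
   Context: Graphs are finite, loopless, and may have multiple edges. $l(\emptyset)=0$. $l$ is intersecting supermodular if $l(A\cap B)+l(A\cup B)\ge l(A)+l(B)$ whenever $A\cap B\neq\emptyset$. For a partition $P$ of $V(K)$, $e_K(P)$ is the number of edges joining different parts. $K$ is $l$-partition-connected if $e_K(P)\ge\sum_{A\in P}l(A)-l(V(K))$ for all partitions $P$ of $V(K)$. For intersecting supermodular $l$, $V(G)$ is uniquely partitioned into the maximal sets $Y$ such that $G[Y]$ is $l$-partition-connected (the $l$-partition-connected components of $G$), and $\Theta_l(G)$ is defined as $\sum_{A\in P}l(A)-e_G(P)$ where $P$ is this partition. -}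

module Defs where

open import Level using (Level; _⊔_) renaming (suc to lsuc)
open import Data.Nat as ℕ using (ℕ; zero; suc)
open import Data.Fin using (Fin; _≟_)
open import Data.Fin.Subset using (Subset; _∩_; _∪_; _⊆_; ⊤; ⁅_⁆; Nonempty; _∈_)
open import Data.Fin.Subset.Properties using (_∈?_)
open import Data.Vec using (tabulate)
open import Data.List using (List; length; filter)
open import Data.List.Relation.Unary.All using (All)
open import Data.Product using (Σ; _×_; _,_; proj₁; proj₂)
open import Data.Bool using (Bool)
open import Relation.Nullary using (Dec; yes; no; ¬_; _×-dec_)
open import Relation.Nullary.Decidable using (⌊_⌋; ¬?)
open import Relation.Binary using (Rel; IsTotalOrder)
open import Relation.Binary.PropositionalEquality using (_≡_; _≢_)
open import Algebra.Bundles using (CommutativeRing)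

-- Totally ordered commutative rings (ℝ is an instance). The values of
-- the set function l live in such a ring.

record OrderedCommutativeRing (c ℓ₁ ℓ₂ : Level) : Set (lsuc (c ⊔ ℓ₁ ⊔ ℓ₂)) where
  field
    commutativeRing : CommutativeRing c ℓ₁
  open CommutativeRing commutativeRing public
  field
    _≤_          : Rel Carrier ℓ₂
    isTotalOrder : IsTotalOrder _≈_ _≤_
    +-monoˡ-≤    : ∀ {a b} (d : Carrier) → a ≤ b → (a + d) ≤ (b + d)
    *-nonneg     : ∀ {a b} → 0# ≤ a → 0# ≤ b → 0# ≤ (a * b)

  _−_ : Carrier → Carrier → Carrier
  x − y = x + (- y)

  fromℕ : ℕ → Carrier
  fromℕ zero    = 0#
  fromℕ (suc k) = 1# + fromℕ k

  ∑ : (k : ℕ) → (Fin k → Carrier) → Carrier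
  ∑ zero    f = 0#
  ∑ (suc k) f = f Fin.zero + ∑ k (λ i → f (Fin.suc i))

-- Finite loopless multigraphs on vertex set Fin n: a list of edges
-- (a list, so parallel edges are allowed), each joining distinct vertices.

record Graph (n : ℕ) : Set where
  field
    edges    : List (Fin n × Fin n)
    loopless : All (λ e → proj₁ e ≢ proj₂ e) edges
open Graph public

-- A partition of a vertex set Y ⊆ Fin n is given by a
-- labelling p : Fin n → Fin n; its parts are the nonempty sets
-- part p i ∩ Y.  (Every partition of Y has at most n parts, so labels in
-- Fin n suffice; empty label classes contribute l(∅) = 0 to the sums.)

Labelling : ℕ → Set
Labelling n = Fin n → Fin n

part : ∀ {n} → Labelling n → Fin n → Subset n
part p i = tabulate (λ v → ⌊ p v ≟ i ⌋)

crossEdges : ∀ {n} → Graph n → Subset n → Labelling n → ℕ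
crossEdges G Y p =
  length (filter (λ e → (proj₁ e ∈? Y) ×-dec ((proj₂ e ∈? Y) ×-dec ¬? (p (proj₁ e) ≟ p (proj₂ e))))
                 (edges G))

module _ {c ℓ₁ ℓ₂} (R : OrderedCommutativeRing c ℓ₁ ℓ₂) where
  open OrderedCommutativeRing R

  IntersectingSupermodular : ∀ {n} → (Subset n → Carrier) → Set (ℓ₂)
  IntersectingSupermodular {n} l =
    ∀ (A B : Subset n) → Nonempty (A ∩ B) → (l A + l B) ≤ (l (A ∩ B) + l (A ∪ B))

  partValue : ∀ {n} → Graph n → (Subset n → Carrier) → Subset n → Labelling n → Carrier
  partValue {n} G l Y p = ∑ n (λ i → l (part p i ∩ Y)) − fromℕ (crossEdges G Y p)

  PartitionConnected : ∀ {n} → Graph n → (Subset n → Carrier) → Subset n → Set ℓ₂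
  PartitionConnected {n} G l Y =
    ∀ (p : Labelling n) → (∑ n (λ i → l (part p i ∩ Y)) − l Y) ≤ fromℕ (crossEdges G Y p)

  IsComponentPartition : ∀ {n} → Graph n → (Subset n → Carrier) → Labelling n → Set ℓ₂
  IsComponentPartition {n} G l cp =
    ∀ (i : Fin n) → Nonempty (part cp i) →
      PartitionConnected G l (part cp i) ×
      (∀ (Z : Subset n) → part cp i ⊆ Z → PartitionConnected G l Z → Z ≡ part cp i)

  IsTheta : ∀ {n} → Graph n → (Subset n → Carrier) → Carrier → Set (ℓ₁ ⊔ ℓ₂)
  IsTheta {n} G l t =
    Σ (Labelling n) λ cp → IsComponentPartition G l cp × (t ≈ partValue G l ⊤ cp)

  IsMaxPartValue : ∀ {n} → Graph n → (Subset n → Carrier) → Carrier → Set (ℓ₁ ⊔ ℓ₂)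
  IsMaxPartValue {n} G l t =
    (Σ (Labelling n) λ q → t ≈ partValue G l ⊤ q) ×
    (∀ (q : Labelling n) → partValue G l ⊤ q ≤ t)

module Submission where

-- Let C be the partition into l-partition-connected components and call a vertex set
-- saturated if it is a union of components.  If G[X] is l-partition-connected, then merging
-- all parts of a partition of Y ⊇ X that meet X does not decrease ∑ l(A) − e(P):
-- supermodularity applied along the merged parts, together with the partition-connectivity
-- of X, pays for the edges that stop crossing.  Merging every component turns any partition
-- of a saturated set B into a coarsening of C restricted to B, of no smaller value.
-- By induction on B, l(B) is at most the value of C on B: if not, every partition of B has
-- value at most l(B), because its coarsening either is {B} or splits B into smaller saturated
-- sets, to which the induction hypothesis applies.  So G[B] is l-partition-connected, and by
-- maximality B is a single component, on which both values are l(B).  Taking B = V(G), every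
-- partition has value at most max(l(V(G)), value of C) = value of C.

open import Defs
open import Level using (Level)
open import Function using (_∘_; id)
open import Function.Bundles using (Equivalence)
open import Data.Bool.Properties using (T-≡)
open import Data.Nat as ℕ using (ℕ; zero; suc)
import Data.Nat.Properties as ℕ
open import Data.Fin as Fin using (Fin)
import Data.Fin.Properties as Fin
open import Data.Fin.Subset using (Subset; _∩_; _∪_; _⊆_; _⊂_; ⊤; ⊥; ⋃; Nonempty; Empty; _∈_)
open import Data.Fin.Subset.Properties
  using ( _∈?_; _⊆?_; nonempty?; ∈⊤; ∉⊥; x∈p∪q⁺; x∈p∪q⁻; x∈p∩q⁺; p∩q⊆p; p∩q⊆q; ⊆-antisym
        ; Empty-unique; ∩-zeroʳ; ∪-identityʳ; ∪-assoc)
open import Data.Fin.Subset.Induction using (⊂-wellFounded)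
open import Data.Product using (_,_; _×_; ∃; proj₁; proj₂)
open import Data.Sum using (_⊎_; inj₁; inj₂; [_,_]′)
open import Data.Vec.Properties using (lookup∘tabulate; []=⇒lookup; lookup⇒[]=)
open import Data.List as List using (List; []; _∷_; length; filter)
open import Data.List.Properties using (filter-none)
import Data.List.Relation.Unary.All as All
open import Data.List.Relation.Unary.Any using (here; there)
open import Data.List.Membership.Propositional using () renaming (_∈_ to _∈ₗ_)
open import Data.List.Membership.Propositional.Properties using (∈-allFin)
open import Relation.Nullary using (Dec; yes; no; ¬_; contradiction; _×-dec_)
open import Relation.Nullary.Decidable using (⌊_⌋; toWitness; fromWitness; ¬?; decidable-stable)
open import Relation.Unary using (Decidable)
open import Relation.Binary.Bundles using (Poset)
open import Relation.Binary.Structures using (IsTotalOrder)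
open import Relation.Binary.PropositionalEquality as ≡ using (_≡_; _≢_)
import Relation.Binary.Reasoning.PartialOrder as PosetReasoning
import Relation.Binary.Reasoning.Setoid as SetoidReasoning
import Induction.WellFounded as WellFounded
open import Algebra.Properties.CommutativeMonoid.Sum ℕ.+-0-commutativeMonoid
  using (sum; sum-cong-≗) renaming (∑-distrib-+ to ℕ-∑-distrib-+)
import Algebra.Properties.CommutativeSemigroup as CommutativeSemigroupProperties
import Algebra.Properties.Group as GroupProperties
import Algebra.Properties.Ring as RingProperties
import Algebra.Solver.CommutativeMonoid as CommutativeMonoidSolver

open CommutativeSemigroupProperties ℕ.+-commutativeSemigroup using () renaming (interchange to ℕ-interchange)

term≤sum : ∀ {k} (f : Fin k → ℕ) j → f j ℕ.≤ sum f
term≤sum f Fin.zero    = ℕ.m≤m+n _ _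
term≤sum f (Fin.suc j) = ℕ.≤-trans (term≤sum (f ∘ Fin.suc) j) (ℕ.m≤n+m _ _)

module Counting {A : Set} where

  indicator : ∀ {P : Set} → Dec P → ℕ
  indicator (yes _) = 1
  indicator (no _)  = 0

  indicator-yes : ∀ {P : Set} (P? : Dec P) → P → indicator P? ≡ 1
  indicator-yes (yes _) _ = ≡.refl
  indicator-yes (no ¬p) p = contradiction p ¬p

  count : ∀ {P : A → Set} → Decidable P → List A → ℕ
  count P? xs = length (filter P? xs)

  module _ {P : A → Set} (P? : Decidable P) where

    count-∷ : ∀ x xs → count P? (x ∷ xs) ≡ indicator (P? x) ℕ.+ count P? xs
    count-∷ x xs with P? x
    ... | yes _ = ≡.refl
    ... | no _  = ≡.refl

    count-none : (∀ x → ¬ P x) → ∀ xs → count P? xs ≡ 0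
    count-none ¬P xs = ≡.cong length (filter-none P? (All.universal ¬P xs))

  count-+-≤ : ∀ {P Q R : A → Set} (P? : Decidable P) (Q? : Decidable Q) (R? : Decidable R) →
              (∀ {x} → P x → R x) → (∀ {x} → Q x → R x) → (∀ {x} → P x → ¬ Q x) →
              ∀ xs → count P? xs ℕ.+ count Q? xs ℕ.≤ count R? xs
  count-+-≤ P? Q? R? P⇒R Q⇒R P⇒¬Q []       = ℕ.z≤n
  count-+-≤ P? Q? R? P⇒R Q⇒R P⇒¬Q (x ∷ xs) = begin
    count P? (x ∷ xs) ℕ.+ count Q? (x ∷ xs)
      ≡⟨ ≡.cong₂ ℕ._+_ (count-∷ P? x xs) (count-∷ Q? x xs) ⟩
    (indicator (P? x) ℕ.+ count P? xs) ℕ.+ (indicator (Q? x) ℕ.+ count Q? xs)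
      ≡⟨ ℕ-interchange (indicator (P? x)) (count P? xs) (indicator (Q? x)) (count Q? xs) ⟩
    (indicator (P? x) ℕ.+ indicator (Q? x)) ℕ.+ (count P? xs ℕ.+ count Q? xs)
      ≤⟨ ℕ.+-mono-≤ at-x (count-+-≤ P? Q? R? P⇒R Q⇒R P⇒¬Q xs) ⟩
    indicator (R? x) ℕ.+ count R? xs
      ≡⟨ count-∷ R? x xs ⟨
    count R? (x ∷ xs) ∎
    where
    open ℕ.≤-Reasoning
    at-x : indicator (P? x) ℕ.+ indicator (Q? x) ℕ.≤ indicator (R? x)
    at-x with P? x | Q? x
    ... | yes p | yes q = contradiction q (P⇒¬Q p)
    ... | yes p | no _  = ℕ.≤-reflexive (≡.sym (indicator-yes (R? x) (P⇒R p)))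
    ... | no _  | yes q = ℕ.≤-reflexive (≡.sym (indicator-yes (R? x) (Q⇒R q)))
    ... | no _  | no _  = ℕ.z≤n

  count-≤-+-sum : ∀ {k} {P Q : A → Set} {S : Fin k → A → Set}
                  (P? : Decidable P) (Q? : Decidable Q) (S? : ∀ j → Decidable (S j)) →
                  (∀ {x} → P x → Q x ⊎ ∃ λ j → S j x) →
                  ∀ xs → count P? xs ℕ.≤ count Q? xs ℕ.+ sum (λ j → count (S? j) xs)
  count-≤-+-sum P? Q? S? cover []       = ℕ.z≤n
  count-≤-+-sum P? Q? S? cover (x ∷ xs) = begin
    count P? (x ∷ xs)
      ≡⟨ count-∷ P? x xs ⟩
    indicator (P? x) ℕ.+ count P? xs
      ≤⟨ ℕ.+-mono-≤ at-x (count-≤-+-sum P? Q? S? cover xs) ⟩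
    (indicator (Q? x) ℕ.+ sum (λ j → indicator (S? j x))) ℕ.+ (count Q? xs ℕ.+ sum (λ j → count (S? j) xs))
      ≡⟨ ℕ-interchange (indicator (Q? x)) (sum (λ j → indicator (S? j x))) (count Q? xs) _ ⟩
    (indicator (Q? x) ℕ.+ count Q? xs) ℕ.+ (sum (λ j → indicator (S? j x)) ℕ.+ sum (λ j → count (S? j) xs))
      ≡⟨ ≡.cong₂ ℕ._+_ (count-∷ Q? x xs)
                       (ℕ-∑-distrib-+ (λ j → indicator (S? j x)) (λ j → count (S? j) xs)) ⟨
    count Q? (x ∷ xs) ℕ.+ sum (λ j → indicator (S? j x) ℕ.+ count (S? j) xs)
      ≡⟨ ≡.cong (count Q? (x ∷ xs) ℕ.+_) (sum-cong-≗ (λ j → count-∷ (S? j) x xs)) ⟨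
    count Q? (x ∷ xs) ℕ.+ sum (λ j → count (S? j) (x ∷ xs)) ∎
    where
    open ℕ.≤-Reasoning
    at-x : indicator (P? x) ℕ.≤ indicator (Q? x) ℕ.+ sum (λ j → indicator (S? j x))
    at-x with P? x
    ... | no _  = ℕ.z≤n
    ... | yes p with cover p
    ...   | inj₁ q       = ℕ.≤-trans (ℕ.≤-reflexive (≡.sym (indicator-yes (Q? x) q))) (ℕ.m≤m+n _ _)
    ...   | inj₂ (j , s) = ℕ.≤-trans (ℕ.≤-reflexive (≡.sym (indicator-yes (S? j x) s)))
                             (ℕ.≤-trans (term≤sum (λ j → indicator (S? j x)) j) (ℕ.m≤n+m _ _))

module OrderedCommutativeRingProperties
  {c ℓ₁ ℓ₂} (R : OrderedCommutativeRing c ℓ₁ ℓ₂) where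

  open OrderedCommutativeRing R renaming (_≤_ to infix 4 _≤_; _−_ to infixl 6 _−_)
  open IsTotalOrder isTotalOrder public
    using (total; isPartialOrder; ≤-respˡ-≈; ≤-respʳ-≈)
    renaming (refl to ≤-refl; reflexive to ≤-reflexive; trans to ≤-trans)
  open RingProperties ring using (-0#≈0#; -1*x≈-x)
  open GroupProperties +-group using (//-rightDividesˡ; //-rightDividesʳ; ⁻¹-involutive)
  open CommutativeMonoidSolver +-commutativeMonoid public using (solve; _⊜_; _⊕_)
  open CommutativeSemigroupProperties +-commutativeSemigroup public using (interchange)

  poset : Poset c ℓ₁ ℓ₂
  poset = record { isPartialOrder = isPartialOrder }

  module ≤-Reasoning = PosetReasoning poset
  module ≈-Reasoning = SetoidReasoning setoid

  +-monoʳ-≤ : ∀ {x y} (d : Carrier) → x ≤ y → d + x ≤ d + y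
  +-monoʳ-≤ {x} {y} d x≤y = ≤-respˡ-≈ (+-comm x d) (≤-respʳ-≈ (+-comm y d) (+-monoˡ-≤ d x≤y))

  +-mono-≤ : ∀ {a b x y} → a ≤ b → x ≤ y → a + x ≤ b + y
  +-mono-≤ {a} {b} {x} a≤b x≤y = ≤-trans (+-monoˡ-≤ x a≤b) (+-monoʳ-≤ b x≤y)

  +-cancelʳ-≤ : ∀ {x y} (d : Carrier) → x + d ≤ y + d → x ≤ y
  +-cancelʳ-≤ {x} {y} d h =
    ≤-respˡ-≈ (//-rightDividesʳ d x) (≤-respʳ-≈ (//-rightDividesʳ d y) (+-monoˡ-≤ (- d) h))

  x−y≤z⇒x≤z+y : ∀ {x y z} → x − y ≤ z → x ≤ z + y
  x−y≤z⇒x≤z+y {x} {y} h = ≤-respˡ-≈ (//-rightDividesˡ y x) (+-monoˡ-≤ y h)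

  x≤y+z⇒x−y≤z : ∀ {x y z} → x ≤ y + z → x − y ≤ z
  x≤y+z⇒x−y≤z {x} {y} {z} h =
    ≤-respʳ-≈ (trans (+-congʳ (+-comm y z)) (//-rightDividesʳ y z)) (+-monoˡ-≤ (- y) h)

  −-mono-≤ : ∀ {x y u v} → x + v ≤ y + u → x − u ≤ y − v
  −-mono-≤ {x} {y} {u} {v} h =
    +-cancelʳ-≤ (u + v) (≤-respˡ-≈ (cancel x u v) (≤-respʳ-≈ (trans (cancel y v u) (+-congˡ (+-comm v u))) h))
    where
    cancel : ∀ a b d → a + d ≈ (a − b) + (b + d)
    cancel a b d = sym (trans (sym (+-assoc (a − b) b d)) (+-congʳ (//-rightDividesˡ b a)))

  0≤1 : 0# ≤ 1#
  0≤1 with total 0# 1#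
  ... | inj₁ 0≤1 = 0≤1
  ... | inj₂ 1≤0 = ≤-respʳ-≈ (trans (-1*x≈-x (- 1#)) (⁻¹-involutive 1#)) (*-nonneg 0≤−1 0≤−1)
    where
    0≤−1 : 0# ≤ - 1#
    0≤−1 = ≤-respˡ-≈ (-‿inverseʳ 1#) (≤-respʳ-≈ (+-identityˡ (- 1#)) (+-monoˡ-≤ (- 1#) 1≤0))

  fromℕ-+ : ∀ a b → fromℕ (a ℕ.+ b) ≈ fromℕ a + fromℕ b
  fromℕ-+ zero    b = sym (+-identityˡ _)
  fromℕ-+ (suc a) b = trans (+-congˡ (fromℕ-+ a b)) (sym (+-assoc _ _ _))

  0≤fromℕ : ∀ a → 0# ≤ fromℕ a
  0≤fromℕ zero    = ≤-refl
  0≤fromℕ (suc a) = ≤-respˡ-≈ (+-identityˡ 0#) (+-mono-≤ 0≤1 (0≤fromℕ a))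

  fromℕ-mono-≤ : ∀ {a b} → a ℕ.≤ b → fromℕ a ≤ fromℕ b
  fromℕ-mono-≤ {a} {b} a≤b =
    ≤-respˡ-≈ (+-identityʳ _)
      (≤-respʳ-≈ (trans (sym (fromℕ-+ a (b ℕ.∸ a))) (reflexive (≡.cong fromℕ (ℕ.m+[n∸m]≡n a≤b))))
        (+-monoʳ-≤ (fromℕ a) (0≤fromℕ (b ℕ.∸ a))))

  x−0≈x : ∀ x → x − 0# ≈ x
  x−0≈x x = trans (+-congˡ -0#≈0#) (+-identityʳ x)

  x≤y−z⇒x+z≤y : ∀ {x y z} → x ≤ y − z → x + z ≤ y
  x≤y−z⇒x+z≤y {x} {y} {z} h = ≤-respʳ-≈ (//-rightDividesˡ z y) (+-monoˡ-≤ z h)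

  ∑-cong : ∀ k {f g : Fin k → Carrier} → (∀ i → f i ≈ g i) → ∑ k f ≈ ∑ k g
  ∑-cong zero    f≈g = refl
  ∑-cong (suc k) f≈g = +-cong (f≈g Fin.zero) (∑-cong k (λ i → f≈g (Fin.suc i)))

  ∑-mono-≤ : ∀ k {f g : Fin k → Carrier} → (∀ i → f i ≤ g i) → ∑ k f ≤ ∑ k g
  ∑-mono-≤ zero    f≤g = ≤-refl
  ∑-mono-≤ (suc k) f≤g = +-mono-≤ (f≤g Fin.zero) (∑-mono-≤ k (λ i → f≤g (Fin.suc i)))

  ∑-zero : ∀ k {f : Fin k → Carrier} → (∀ i → f i ≈ 0#) → ∑ k f ≈ 0#
  ∑-zero zero    f≈0 = refl
  ∑-zero (suc k) f≈0 = trans (+-cong (f≈0 Fin.zero) (∑-zero k (λ i → f≈0 (Fin.suc i)))) (+-identityˡ 0#)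

  ∑-distrib-+ : ∀ k (f g : Fin k → Carrier) → ∑ k (λ i → f i + g i) ≈ ∑ k f + ∑ k g
  ∑-distrib-+ zero    f g = sym (+-identityˡ 0#)
  ∑-distrib-+ (suc k) f g =
    trans (+-congˡ (∑-distrib-+ k (λ i → f (Fin.suc i)) (λ i → g (Fin.suc i))))
          (interchange _ _ _ _)

  ∑-comm : ∀ a b (f : Fin a → Fin b → Carrier) →
           ∑ a (λ i → ∑ b (f i)) ≈ ∑ b (λ j → ∑ a (λ i → f i j))
  ∑-comm zero    b f = sym (∑-zero b (λ _ → refl))
  ∑-comm (suc a) b f =
    trans (+-congˡ (∑-comm a b (λ i → f (Fin.suc i)))) (sym (∑-distrib-+ b (f Fin.zero) _))

  ∑-cong-except : ∀ k {f g : Fin k → Carrier} j → (∀ i → i ≢ j → f i ≈ g i) →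
                  ∑ k f + g j ≈ ∑ k g + f j
  ∑-cong-except (suc k) Fin.zero f≈g =
    trans (solve 3 (λ a b c → (a ⊕ b) ⊕ c ⊜ (c ⊕ b) ⊕ a) refl _ _ _)
          (+-congʳ (+-congˡ (∑-cong k (λ i → f≈g (Fin.suc i) (λ ())))))
  ∑-cong-except (suc k) (Fin.suc j) f≈g =
    trans (solve 3 (λ a b c → (a ⊕ b) ⊕ c ⊜ a ⊕ (b ⊕ c)) refl _ _ _)
      (trans (+-cong (f≈g Fin.zero (λ ()))
                     (∑-cong-except k j (λ i i≢j → f≈g (Fin.suc i) (i≢j ∘ Fin.suc-injective))))
             (solve 3 (λ a b c → a ⊕ (b ⊕ c) ⊜ (a ⊕ b) ⊕ c) refl _ _ _))

  ∑-single : ∀ k {f : Fin k → Carrier} j → (∀ i → i ≢ j → f i ≈ 0#) → ∑ k f ≈ f j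
  ∑-single k {f} j f≈0 = begin
    ∑ k f                       ≈⟨ sym (+-identityʳ _) ⟩
    ∑ k f + 0#                  ≈⟨ ∑-cong-except k j f≈0 ⟩
    ∑ k (λ _ → 0#) + f j        ≈⟨ +-congʳ (∑-zero k (λ _ → refl)) ⟩
    0# + f j                    ≈⟨ +-identityˡ (f j) ⟩
    f j                         ∎
    where open ≈-Reasoning

  fromℕ-sum : ∀ k (f : Fin k → ℕ) → fromℕ (sum f) ≈ ∑ k (λ j → fromℕ (f j))
  fromℕ-sum zero    f = refl
  fromℕ-sum (suc k) f = trans (fromℕ-+ (f Fin.zero) _) (+-congˡ (fromℕ-sum k (f ∘ Fin.suc)))

module _ {n : ℕ} where

  ∈-part⁻ : ∀ {p : Labelling n} {i x} → x ∈ part p i → p x ≡ i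
  ∈-part⁻ {p} {i} {x} x∈ =
    toWitness (Equivalence.from T-≡
      (≡.trans (≡.sym (lookup∘tabulate (λ v → ⌊ p v Fin.≟ i ⌋) x)) ([]=⇒lookup x∈)))

  ∈-part⁺ : ∀ {p : Labelling n} {i x} → p x ≡ i → x ∈ part p i
  ∈-part⁺ {p} {i} {x} px≡i =
    lookup⇒[]= x _
      (≡.trans (lookup∘tabulate (λ v → ⌊ p v Fin.≟ i ⌋) x) (Equivalence.to T-≡ (fromWitness px≡i)))

  ∈-∩⁺ : ∀ {x} {A B : Subset n} → x ∈ A → x ∈ B → x ∈ A ∩ B
  ∈-∩⁺ x∈A x∈B = x∈p∩q⁺ (x∈A , x∈B)

  ∈-∩⁻ˡ : ∀ {x} {A B : Subset n} → x ∈ A ∩ B → x ∈ A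
  ∈-∩⁻ˡ {A = A} {B} = p∩q⊆p A B

  ∈-∩⁻ʳ : ∀ {x} {A B : Subset n} → x ∈ A ∩ B → x ∈ B
  ∈-∩⁻ʳ {A = A} {B} = p∩q⊆q A B

  p∩[q∩r]⊆p∩r : ∀ {x} {A B C : Subset n} → x ∈ A ∩ (B ∩ C) → x ∈ A ∩ C
  p∩[q∩r]⊆p∩r x∈ = ∈-∩⁺ (∈-∩⁻ˡ x∈) (∈-∩⁻ʳ (∈-∩⁻ʳ x∈))

  ∈-⋃-tabulate⁺ : ∀ {k} (A : Fin k → Subset n) i {x} → x ∈ A i → x ∈ ⋃ (List.tabulate A)
  ∈-⋃-tabulate⁺ A Fin.zero    x∈ = x∈p∪q⁺ (inj₁ x∈)
  ∈-⋃-tabulate⁺ A (Fin.suc i) x∈ = x∈p∪q⁺ (inj₂ (∈-⋃-tabulate⁺ (A ∘ Fin.suc) i x∈))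

  ⋃-tabulate-⊆ : ∀ {k} (A : Fin k → Subset n) {B} → (∀ i → A i ⊆ B) → ⋃ (List.tabulate A) ⊆ B
  ⋃-tabulate-⊆ {zero}  A A⊆B x∈ = contradiction x∈ ∉⊥
  ⋃-tabulate-⊆ {suc k} A A⊆B x∈ with x∈p∪q⁻ (A Fin.zero) _ x∈
  ... | inj₁ x∈A₀ = A⊆B Fin.zero x∈A₀
  ... | inj₂ x∈⋃  = ⋃-tabulate-⊆ (A ∘ Fin.suc) (A⊆B ∘ Fin.suc) x∈⋃

  ⊆∧⊉⇒⊂ : ∀ {A B : Subset n} → A ⊆ B → ¬ (B ⊆ A) → A ⊂ B
  ⊆∧⊉⇒⊂ {A} {B} A⊆B B⊈A with Fin.any? (λ x → (x ∈? B) ×-dec ¬? (x ∈? A))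
  ... | yes (x , x∈B , x∉A) = A⊆B , x , x∈B , x∉A
  ... | no  ∄x = contradiction (λ {x} x∈B → decidable-stable (x ∈? A) (λ x∉A → ∄x (x , x∈B , x∉A))) B⊈A

module _ {n : ℕ} where

  ConstantOn : Subset n → Labelling n → Set
  ConstantOn Y p = ∀ {x w} → x ∈ Y → w ∈ Y → p x ≡ p w

  CoarserOn : Subset n → Labelling n → Labelling n → Set
  CoarserOn Y q p = ∀ {x w} → x ∈ Y → w ∈ Y → p x ≡ p w → q x ≡ q w

  Saturated : Labelling n → Subset n → Set
  Saturated p Y = ∀ {x w} → p x ≡ p w → x ∈ Y → w ∈ Y

  Meets : Subset n → Labelling n → Fin n → Set
  Meets X Q i = ∃ λ u → u ∈ X × Q u ≡ i

  meets? : ∀ X Q → Decidable (Meets X Q)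
  meets? X Q i = Fin.any? (λ u → (u ∈? X) ×-dec (Q u Fin.≟ i))

  relabel : Subset n → Labelling n → Fin n → Fin n → Fin n
  relabel X Q c i with meets? X Q i
  ... | yes _ = c
  ... | no  _ = i

  relabel-cases : ∀ X Q c i → (Meets X Q i × relabel X Q c i ≡ c) ⊎ (¬ Meets X Q i × relabel X Q c i ≡ i)
  relabel-cases X Q c i with meets? X Q i
  ... | yes m  = inj₁ (m , ≡.refl)
  ... | no  ¬m = inj₂ (¬m , ≡.refl)

  merge : Subset n → Labelling n → Fin n → Labelling n
  merge X Q c = relabel X Q c ∘ Q

  merge-coarser : ∀ {Y} X Q c → CoarserOn Y (merge X Q c) Q
  merge-coarser X Q c _ _ = ≡.cong (relabel X Q c)

  merge-on : ∀ {X} Q c {x} → x ∈ X → merge X Q c x ≡ c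
  merge-on {X} Q c {x} x∈X with relabel-cases X Q c (Q x)
  ... | inj₁ (_ , ≡c)  = ≡c
  ... | inj₂ (¬m , _) = contradiction (x , x∈X , ≡.refl) ¬m

  merge-constantOn : ∀ {X} Q c → ConstantOn X (merge X Q c)
  merge-constantOn Q c x∈ w∈ = ≡.trans (merge-on Q c x∈) (≡.sym (merge-on Q c w∈))

  merge-off : ∀ X Q c {x j} → merge X Q c x ≡ j → j ≢ c → Q x ≡ j
  merge-off X Q c {x} ≡j j≢c with relabel-cases X Q c (Q x)
  ... | inj₁ (_ , ≡c)  = contradiction (≡.trans (≡.sym ≡j) ≡c) j≢c
  ... | inj₂ (_ , ≡Qx) = ≡.trans (≡.sym ≡Qx) ≡j

  merge-onto : ∀ {X} Q {x₀} → x₀ ∈ X → ∀ {x} → merge X Q (Q x₀) x ≡ Q x₀ → Meets X Q (Q x)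
  merge-onto {X} Q {x₀} x₀∈X {x} ≡c with relabel-cases X Q (Q x₀) (Q x)
  ... | inj₁ (m , _)   = m
  ... | inj₂ (_ , ≡Qx) = x₀ , x₀∈X , ≡.trans (≡.sym ≡c) ≡Qx

module CrossEdges {n} (G : Graph n) where
  open Counting

  Crosses : Subset n → Labelling n → Fin n × Fin n → Set
  Crosses Y p e = proj₁ e ∈ Y × (proj₂ e ∈ Y × ¬ (p (proj₁ e) ≡ p (proj₂ e)))

  crosses? : ∀ Y p → Decidable (Crosses Y p)
  crosses? Y p e = (proj₁ e ∈? Y) ×-dec ((proj₂ e ∈? Y) ×-dec ¬? (p (proj₁ e) Fin.≟ p (proj₂ e)))

  crossEdges-none : ∀ {Y p} → ConstantOn Y p → crossEdges G Y p ≡ 0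
  crossEdges-none {Y} {p} p-const =
    count-none (crosses? Y p) (λ _ (x∈ , w∈ , px≢pw) → px≢pw (p-const x∈ w∈)) (edges G)

  crossEdges-merge : ∀ {X Y p q} → X ⊆ Y → CoarserOn Y q p → ConstantOn X q →
                     crossEdges G X p ℕ.+ crossEdges G Y q ℕ.≤ crossEdges G Y p
  crossEdges-merge {X} {Y} {p} {q} X⊆Y q≼p q-const =
    count-+-≤ (crosses? X p) (crosses? Y q) (crosses? Y p)
      (λ (x∈ , w∈ , px≢pw) → X⊆Y x∈ , X⊆Y w∈ , px≢pw)
      (λ (x∈ , w∈ , qx≢qw) → x∈ , w∈ , qx≢qw ∘ q≼p x∈ w∈)
      (λ (x∈ , w∈ , _) (_ , _ , qx≢qw) → qx≢qw (q-const x∈ w∈))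
      (edges G)

  crossEdges-split : ∀ Y p q →
    crossEdges G Y p ℕ.≤ crossEdges G Y q ℕ.+ sum (λ j → crossEdges G (part q j ∩ Y) p)
  crossEdges-split Y p q =
    count-≤-+-sum (crosses? Y p) (crosses? Y q) (λ j → crosses? (part q j ∩ Y) p) cover (edges G)
    where
    cover : ∀ {e} → Crosses Y p e → Crosses Y q e ⊎ ∃ λ j → Crosses (part q j ∩ Y) p e
    cover {x , w} (x∈ , w∈ , px≢pw) with q x Fin.≟ q w
    ... | no qx≢qw  = inj₁ (x∈ , w∈ , qx≢qw)
    ... | yes qx≡qw =
      inj₂ (q x , ∈-∩⁺ (∈-part⁺ ≡.refl) x∈ , ∈-∩⁺ (∈-part⁺ (≡.sym qx≡qw)) w∈ , px≢pw)

module _ {c ℓ₁ ℓ₂} (R : OrderedCommutativeRing c ℓ₁ ℓ₂) where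

  open OrderedCommutativeRing R renaming (_≤_ to infix 4 _≤_; _−_ to infixl 6 _−_)
  open OrderedCommutativeRingProperties R

  module PartitionValues
    {n} (G : Graph n)
    (l : Subset n → Carrier) (l∅ : l ⊥ ≈ 0#) where

    open CrossEdges G

    L : Subset n → Labelling n → Carrier
    L Y p = ∑ n (λ i → l (part p i ∩ Y))

    V : Subset n → Labelling n → Carrier
    V = partValue R G l

    l-empty : ∀ {A} → Empty A → l A ≈ 0#
    l-empty A-empty = trans (reflexive (≡.cong l (Empty-unique A-empty))) l∅

    L-const : ∀ {Y p} j → (∀ {x} → x ∈ Y → p x ≡ j) → L Y p ≈ l Y
    L-const {Y} {p} j p≡j =
      trans (∑-single n j (λ i i≢j → l-empty (λ (x , x∈) → i≢j (other-class x∈))))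
            (reflexive (≡.cong l (⊆-antisym ∈-∩⁻ʳ (λ x∈ → ∈-∩⁺ (∈-part⁺ (p≡j x∈)) x∈))))
      where
      other-class : ∀ {x i} → x ∈ part p i ∩ Y → i ≡ j
      other-class x∈ = ≡.trans (≡.sym (∈-part⁻ (∈-∩⁻ˡ x∈))) (p≡j (∈-∩⁻ʳ x∈))

    L-empty : ∀ {Y} p → Empty Y → L Y p ≈ 0#
    L-empty p Y-empty = ∑-zero n (λ i → l-empty (λ (x , x∈) → Y-empty (x , ∈-∩⁻ʳ x∈)))

    L-refine : ∀ {Y q p} → CoarserOn Y q p → ∑ n (λ j → L (part q j ∩ Y) p) ≈ L Y p
    L-refine {Y} {q} {p} q≼p =
      trans (∑-comm n n (λ j i → l (part p i ∩ (part q j ∩ Y)))) (∑-cong n per-class)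
      where
      per-class : ∀ i → ∑ n (λ j → l (part p i ∩ (part q j ∩ Y))) ≈ l (part p i ∩ Y)
      per-class i with nonempty? (part p i ∩ Y)
      ... | no  empty =
        trans (∑-zero n (λ j → l-empty (λ (x , x∈) → empty (x , p∩[q∩r]⊆p∩r x∈))))
              (sym (l-empty empty))
      ... | yes (u , u∈) =
        trans (∑-single n (q u) (λ j j≢qu → l-empty (λ (x , x∈) → j≢qu (other-class x∈))))
              (reflexive (≡.cong l (⊆-antisym p∩[q∩r]⊆p∩r
                (λ x∈ → ∈-∩⁺ (∈-∩⁻ˡ x∈) (∈-∩⁺ (∈-part⁺ (same-class x∈)) (∈-∩⁻ʳ x∈))))))
        where
        same-class : ∀ {x} → x ∈ part p i ∩ Y → q x ≡ q u
        same-class x∈ =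
          q≼p (∈-∩⁻ʳ x∈) (∈-∩⁻ʳ u∈) (≡.trans (∈-part⁻ (∈-∩⁻ˡ x∈)) (≡.sym (∈-part⁻ (∈-∩⁻ˡ u∈))))
        other-class : ∀ {x j} → x ∈ part p i ∩ (part q j ∩ Y) → j ≡ q u
        other-class x∈ = ≡.trans (≡.sym (∈-part⁻ (∈-∩⁻ˡ (∈-∩⁻ʳ x∈)))) (same-class (p∩[q∩r]⊆p∩r x∈))

    partValue-const : ∀ {Y p} j → (∀ {x} → x ∈ Y → p x ≡ j) → V Y p ≈ l Y
    partValue-const {Y} {p} j p≡j = begin
      L Y p − fromℕ (crossEdges G Y p) ≡⟨ ≡.cong (λ k → L Y p − fromℕ k) (crossEdges-none p-const) ⟩
      L Y p − 0#                       ≈⟨ x−0≈x (L Y p) ⟩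
      L Y p                            ≈⟨ L-const j p≡j ⟩
      l Y                              ∎
      where
      open ≈-Reasoning
      p-const : ConstantOn Y p
      p-const x∈ w∈ = ≡.trans (p≡j x∈) (≡.sym (p≡j w∈))

    partValue-empty : ∀ {Y} p → Empty Y → V Y p ≈ 0#
    partValue-empty {Y} p Y-empty = begin
      L Y p − fromℕ (crossEdges G Y p) ≡⟨ ≡.cong (λ k → L Y p − fromℕ k) (crossEdges-none p-const) ⟩
      L Y p − 0#                       ≈⟨ x−0≈x (L Y p) ⟩
      L Y p                            ≈⟨ L-empty p Y-empty ⟩
      0#                               ∎
      where
      open ≈-Reasoning
      p-const : ConstantOn Y p
      p-const x∈ _ = contradiction (_ , x∈) Y-empty

    partitionConnected-from-≤ : ∀ {Y} → (∀ p → V Y p ≤ l Y) → PartitionConnected R G l Y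
    partitionConnected-from-≤ V≤l p = x≤y+z⇒x−y≤z (x−y≤z⇒x≤z+y (V≤l p))

    partValue-coarsen-≤ : ∀ {Y q p} → CoarserOn Y q p →
                          (∀ j → l (part q j ∩ Y) ≤ V (part q j ∩ Y) p) → V Y q ≤ V Y p
    partValue-coarsen-≤ {Y} {q} {p} q≼p l≤V = −-mono-≤ (begin
      L Y q + fromℕ (e Y p)                ≤⟨ +-monoʳ-≤ (L Y q) (fromℕ-mono-≤ (crossEdges-split Y p q)) ⟩
      L Y q + fromℕ (e Y q ℕ.+ E)          ≈⟨ +-congˡ (fromℕ-+ (e Y q) E) ⟩
      L Y q + (fromℕ (e Y q) + fromℕ E)    ≈⟨ solve 3 (λ a b c → a ⊕ (b ⊕ c) ⊜ (a ⊕ c) ⊕ b) refl _ _ _ ⟩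
      (L Y q + fromℕ E) + fromℕ (e Y q)    ≤⟨ +-monoˡ-≤ (fromℕ (e Y q)) parts ⟩
      L Y p + fromℕ (e Y q)                ∎)
      where
      open ≤-Reasoning
      e : Subset n → Labelling n → ℕ
      e = crossEdges G
      D : Fin n → Subset n
      D j = part q j ∩ Y
      E : ℕ
      E = sum (λ j → e (D j) p)
      parts : L Y q + fromℕ E ≤ L Y p
      parts = begin
        L Y q + fromℕ E                                       ≈⟨ +-congˡ (fromℕ-sum n (λ j → e (D j) p)) ⟩
        ∑ n (λ j → l (D j)) + ∑ n (λ j → fromℕ (e (D j) p))   ≈⟨ sym (∑-distrib-+ n _ _) ⟩
        ∑ n (λ j → l (D j) + fromℕ (e (D j) p))               ≤⟨ ∑-mono-≤ n (λ j → x≤y−z⇒x+z≤y (l≤V j)) ⟩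
        ∑ n (λ j → L (D j) p)                                 ≈⟨ L-refine q≼p ⟩
        L Y p                                                 ∎

  module SupermodularChain {n} (l : Subset n → Carrier) (sup : IntersectingSupermodular R l) where

    supermodular-∪ : ∀ X A → (Nonempty A → Nonempty (X ∩ A)) → l X + l A ≤ l (X ∩ A) + l (X ∪ A)
    supermodular-∪ X A meets with nonempty? A
    ... | yes A≠∅ = sup X A (meets A≠∅)
    ... | no  A=∅ rewrite Empty-unique A=∅ | ∩-zeroʳ X | ∪-identityʳ X = ≤-reflexive (+-comm (l X) (l ⊥))

    supermodular-chain : ∀ k (A : Fin k → Subset n) X →
      (∀ i j → i ≢ j → Empty (A i ∩ A j)) →
      (∀ i → Nonempty (A i) → Nonempty (X ∩ A i)) →
      l X + ∑ k (λ i → l (A i)) ≤ ∑ k (λ i → l (X ∩ A i)) + l (X ∪ ⋃ (List.tabulate A))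
    supermodular-chain zero    A X disjoint meets rewrite ∪-identityʳ X = ≤-reflexive (+-comm (l X) 0#)
    supermodular-chain (suc k) A X disjoint meets = +-cancelʳ-≤ (l X′) (begin
      (l X + (l A₀ + ∑ k (l ∘ A′))) + l X′
        ≈⟨ solve 4 (λ x a s x′ → (x ⊕ (a ⊕ s)) ⊕ x′ ⊜ (x ⊕ a) ⊕ (x′ ⊕ s)) refl _ _ _ _ ⟩
      (l X + l A₀) + (l X′ + ∑ k (l ∘ A′))
        ≤⟨ +-mono-≤ (supermodular-∪ X A₀ (meets Fin.zero)) tail ⟩
      (l (X ∩ A₀) + l X′) + (∑ k (λ i → l (X′ ∩ A′ i)) + l (X′ ∪ U′))
        ≈⟨ +-congˡ (+-cong (∑-cong k (λ i → reflexive (≡.cong l (X′∩A′≡X∩A′ i))))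
                           (reflexive (≡.cong l (∪-assoc X A₀ U′)))) ⟩
      (l (X ∩ A₀) + l X′) + (∑ k (λ i → l (X ∩ A′ i)) + l (X ∪ (A₀ ∪ U′)))
        ≈⟨ solve 4 (λ a x′ s u → (a ⊕ x′) ⊕ (s ⊕ u) ⊜ ((a ⊕ s) ⊕ u) ⊕ x′) refl _ _ _ _ ⟩
      ((l (X ∩ A₀) + ∑ k (λ i → l (X ∩ A′ i))) + l (X ∪ (A₀ ∪ U′))) + l X′ ∎)
      where
      open ≤-Reasoning
      A′ : Fin k → Subset n
      A′ = A ∘ Fin.suc
      A₀ X′ U′ : Subset n
      A₀ = A Fin.zero
      X′ = X ∪ A₀
      U′ = ⋃ (List.tabulate A′)
      A₀∩A′=∅ : ∀ i → Empty (A₀ ∩ A′ i)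
      A₀∩A′=∅ i = disjoint Fin.zero (Fin.suc i) (λ ())
      X′∩A′≡X∩A′ : ∀ i → X′ ∩ A′ i ≡ X ∩ A′ i
      X′∩A′≡X∩A′ i = ⊆-antisym
        (λ x∈ → ∈-∩⁺ ([ id , (λ x∈A₀ → contradiction (_ , ∈-∩⁺ x∈A₀ (∈-∩⁻ʳ x∈)) (A₀∩A′=∅ i)) ]′
                        (x∈p∪q⁻ X A₀ (∈-∩⁻ˡ x∈)))
                     (∈-∩⁻ʳ x∈))
        (λ x∈ → ∈-∩⁺ (x∈p∪q⁺ (inj₁ (∈-∩⁻ˡ x∈))) (∈-∩⁻ʳ x∈))
      tail : l X′ + ∑ k (l ∘ A′) ≤ ∑ k (λ i → l (X′ ∩ A′ i)) + l (X′ ∪ U′)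
      tail = supermodular-chain k A′ X′
        (λ i j i≢j → disjoint (Fin.suc i) (Fin.suc j) (i≢j ∘ Fin.suc-injective))
        (λ i A′≠∅ → let (x , x∈) = meets (Fin.suc i) A′≠∅ in
                     x , ∈-∩⁺ (x∈p∪q⁺ (inj₁ (∈-∩⁻ˡ x∈))) (∈-∩⁻ʳ x∈))

  module Merging
    {n} (G : Graph n)
    (l : Subset n → Carrier) (l∅ : l ⊥ ≈ 0#) (sup : IntersectingSupermodular R l) where

    open CrossEdges G
    open PartitionValues G l l∅
    open SupermodularChain l sup

    -- Only the class S of Q′ differs from the classes of Q, so V Y Q′ − V Y Q is
    -- (l S − L S Q) + (e Y Q − e Y Q′); supermodularity along the parts of Q inside S and
    -- the partition-connectivity of X bound the first term below by l X − L X Q ≥ − e X Q.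
    partValue-merge-≤ : ∀ {X Y x₀} → X ⊆ Y → x₀ ∈ X → PartitionConnected R G l X →
                        ∀ Q → V Y Q ≤ V Y (merge X Q (Q x₀))
    partValue-merge-≤ {X} {Y} {x₀} X⊆Y x₀∈X X-connected Q = −-mono-≤ (+-cancelʳ-≤ (l S + l X) (begin
      (L Y Q + e Y Q′) + (l S + l X)              ≈⟨ interchange _ _ _ _ ⟩
      (L Y Q + l S) + (e Y Q′ + l X)              ≈⟨ +-congʳ exchange ⟩
      (L Y Q′ + L S Q) + (e Y Q′ + l X)           ≈⟨ interchange _ _ _ _ ⟩
      (L Y Q′ + e Y Q′) + (L S Q + l X)           ≤⟨ +-monoʳ-≤ _ chain ⟩
      (L Y Q′ + e Y Q′) + (L X Q + l S)
        ≤⟨ +-monoʳ-≤ _ (+-monoˡ-≤ (l S) (x−y≤z⇒x≤z+y (X-connected Q))) ⟩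
      (L Y Q′ + e Y Q′) + ((e X Q + l X) + l S)
        ≈⟨ solve 5 (λ a b c d f → (a ⊕ b) ⊕ ((c ⊕ d) ⊕ f) ⊜ (a ⊕ (c ⊕ b)) ⊕ (f ⊕ d)) refl _ _ _ _ _ ⟩
      (L Y Q′ + (e X Q + e Y Q′)) + (l S + l X)   ≤⟨ +-monoˡ-≤ _ (+-monoʳ-≤ _ fewer-crossings) ⟩
      (L Y Q′ + e Y Q) + (l S + l X)              ∎))
      where
      open ≤-Reasoning
      t : Fin n
      t = Q x₀
      Q′ : Labelling n
      Q′ = merge X Q t
      e : Subset n → Labelling n → Carrier
      e Z p = fromℕ (crossEdges G Z p)
      D : Fin n → Subset n
      D j = part Q′ j ∩ Y
      S : Subset n
      S = D t
      X⊆S : X ⊆ S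
      X⊆S x∈X = ∈-∩⁺ (∈-part⁺ (merge-on Q t x∈X)) (X⊆Y x∈X)
      exchange : L Y Q + l S ≈ L Y Q′ + L S Q
      exchange = trans (+-congʳ (sym (L-refine (merge-coarser X Q t))))
        (∑-cong-except n t (λ j j≢t → L-const j (λ x∈ → merge-off X Q t (∈-part⁻ (∈-∩⁻ˡ x∈)) j≢t)))
      fewer-crossings : e X Q + e Y Q′ ≤ e Y Q
      fewer-crossings = ≤-respˡ-≈ (fromℕ-+ (crossEdges G X Q) (crossEdges G Y Q′))
                (fromℕ-mono-≤ (crossEdges-merge X⊆Y (merge-coarser X Q t) (merge-constantOn Q t)))
      A : Fin n → Subset n
      A i = part Q i ∩ S
      chain : L S Q + l X ≤ L X Q + l S
      chain = begin
        L S Q + l X  ≈⟨ +-comm _ _ ⟩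
        l X + L S Q  ≤⟨ supermodular-chain n A X disjoint meets ⟩
        ∑ n (λ i → l (X ∩ A i)) + l (X ∪ ⋃ (List.tabulate A))
          ≈⟨ +-cong (∑-cong n (λ i → reflexive (≡.cong l (X∩A≡ i)))) (reflexive (≡.cong l X∪⋃A≡S)) ⟩
        L X Q + l S ∎
        where
        disjoint : ∀ i j → i ≢ j → Empty (A i ∩ A j)
        disjoint i j i≢j (x , x∈) =
          i≢j (≡.trans (≡.sym (∈-part⁻ (∈-∩⁻ˡ (∈-∩⁻ˡ x∈)))) (∈-part⁻ (∈-∩⁻ˡ (∈-∩⁻ʳ x∈))))
        meets : ∀ i → Nonempty (A i) → Nonempty (X ∩ A i)
        meets i (x , x∈) with merge-onto Q x₀∈X (∈-part⁻ (∈-∩⁻ˡ (∈-∩⁻ʳ x∈)))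
        ... | u , u∈X , Qu≡Qx =
          u , ∈-∩⁺ u∈X (∈-∩⁺ (∈-part⁺ (≡.trans Qu≡Qx (∈-part⁻ (∈-∩⁻ˡ x∈)))) (X⊆S u∈X))
        X∩A≡ : ∀ i → X ∩ A i ≡ part Q i ∩ X
        X∩A≡ i = ⊆-antisym (λ x∈ → ∈-∩⁺ (∈-∩⁻ˡ (∈-∩⁻ʳ x∈)) (∈-∩⁻ˡ x∈))
                           (λ x∈ → ∈-∩⁺ (∈-∩⁻ʳ x∈) (∈-∩⁺ (∈-∩⁻ˡ x∈) (X⊆S (∈-∩⁻ʳ x∈))))
        X∪⋃A≡S : X ∪ ⋃ (List.tabulate A) ≡ S
        X∪⋃A≡S = ⊆-antisym (λ x∈ → [ X⊆S , ⋃-tabulate-⊆ A (λ i → ∈-∩⁻ʳ) ]′ (x∈p∪q⁻ X _ x∈))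
                           (λ x∈ → x∈p∪q⁺ (inj₂ (∈-⋃-tabulate⁺ A _ (∈-∩⁺ (∈-part⁺ ≡.refl) x∈))))

  module ComponentPartition
    {n} (G : Graph n)
    (l : Subset n → Carrier) (l∅ : l ⊥ ≈ 0#) (sup : IntersectingSupermodular R l)
    (cp : Labelling n) (cp-components : IsComponentPartition R G l cp) where

    open PartitionValues G l l∅
    open Merging G l l∅ sup

    module _ {B} (B-saturated : Saturated cp B) where

      component-connected : ∀ {k x} → x ∈ part cp k ∩ B → PartitionConnected R G l (part cp k ∩ B)
      component-connected {k} {x} x∈ = ≡.subst (PartitionConnected R G l) (≡.sym component⊆B)
                                               (proj₁ (cp-components k (x , ∈-∩⁻ˡ x∈)))
        where
        component⊆B : part cp k ∩ B ≡ part cp k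
        component⊆B = ⊆-antisym ∈-∩⁻ˡ (λ w∈ →
          ∈-∩⁺ w∈ (B-saturated (≡.trans (∈-part⁻ (∈-∩⁻ˡ x∈)) (≡.sym (∈-part⁻ w∈))) (∈-∩⁻ʳ x∈)))

      mergeComponent : Fin n → Labelling n → Labelling n
      mergeComponent k Q with nonempty? (part cp k ∩ B)
      ... | yes (x₀ , _) = merge (part cp k ∩ B) Q (Q x₀)
      ... | no  _        = Q

      mergeComponent-≤ : ∀ k Q → V B Q ≤ V B (mergeComponent k Q)
      mergeComponent-≤ k Q with nonempty? (part cp k ∩ B)
      ... | yes (x₀ , x₀∈) = partValue-merge-≤ ∈-∩⁻ʳ x₀∈ (component-connected x₀∈) Q
      ... | no  _          = ≤-refl

      mergeComponent-coarser : ∀ k Q {u w} → Q u ≡ Q w → mergeComponent k Q u ≡ mergeComponent k Q w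
      mergeComponent-coarser k Q Qu≡Qw with nonempty? (part cp k ∩ B)
      ... | yes (x₀ , _) = ≡.cong (relabel (part cp k ∩ B) Q (Q x₀)) Qu≡Qw
      ... | no  _        = Qu≡Qw

      mergeComponent-joins : ∀ k Q → ConstantOn (part cp k ∩ B) (mergeComponent k Q)
      mergeComponent-joins k Q u∈ w∈ with nonempty? (part cp k ∩ B)
      ... | yes (x₀ , _) = merge-constantOn Q (Q x₀) u∈ w∈
      ... | no  empty    = contradiction (_ , u∈) empty

      mergeComponents : List (Fin n) → Labelling n → Labelling n
      mergeComponents []       Q = Q
      mergeComponents (k ∷ ks) Q = mergeComponents ks (mergeComponent k Q)

      mergeComponents-≤ : ∀ ks Q → V B Q ≤ V B (mergeComponents ks Q)
      mergeComponents-≤ []       Q = ≤-refl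
      mergeComponents-≤ (k ∷ ks) Q = ≤-trans (mergeComponent-≤ k Q) (mergeComponents-≤ ks (mergeComponent k Q))

      mergeComponents-coarser : ∀ ks Q {u w} → Q u ≡ Q w → mergeComponents ks Q u ≡ mergeComponents ks Q w
      mergeComponents-coarser []       Q Qu≡Qw = Qu≡Qw
      mergeComponents-coarser (k ∷ ks) Q Qu≡Qw =
        mergeComponents-coarser ks (mergeComponent k Q) (mergeComponent-coarser k Q Qu≡Qw)

      mergeComponents-joins : ∀ ks Q {k} → k ∈ₗ ks → ConstantOn (part cp k ∩ B) (mergeComponents ks Q)
      mergeComponents-joins (k ∷ ks) Q (here ≡.refl) u∈ w∈ =
        mergeComponents-coarser ks (mergeComponent k Q) (mergeComponent-joins k Q u∈ w∈)
      mergeComponents-joins (_ ∷ ks) Q (there k∈ks) = mergeComponents-joins ks (mergeComponent _ Q) k∈ks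

      coarsen : Labelling n → Labelling n
      coarsen = mergeComponents (List.allFin n)

      coarsen-coarser : ∀ Q → CoarserOn B (coarsen Q) cp
      coarsen-coarser Q u∈ w∈ cpu≡cpw =
        mergeComponents-joins (List.allFin n) Q (∈-allFin (cp _))
          (∈-∩⁺ (∈-part⁺ ≡.refl) u∈) (∈-∩⁺ (∈-part⁺ (≡.sym cpu≡cpw)) w∈)

      coarsen-≤ : ∀ Q → V B Q ≤ V B (coarsen Q)
      coarsen-≤ = mergeComponents-≤ (List.allFin n)

      partValue-≤-whole-or-components :
        (∀ {D} → D ⊂ B → Saturated cp D → l D ≤ V D cp) →
        ∀ Q → V B Q ≤ l B ⊎ V B Q ≤ V B cp
      partValue-≤-whole-or-components smaller Q with Fin.any? (λ j → B ⊆? part (coarsen Q) j)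
      ... | yes (j , B⊆class) =
        inj₁ (≤-trans (coarsen-≤ Q) (≤-reflexive (partValue-const j (λ x∈ → ∈-part⁻ (B⊆class x∈)))))
      ... | no  ∄class =
        inj₂ (≤-trans (coarsen-≤ Q) (partValue-coarsen-≤ (coarsen-coarser Q) (λ j →
          smaller (⊆∧⊉⇒⊂ ∈-∩⁻ʳ (λ B⊆ → ∄class (j , ∈-∩⁻ˡ ∘ B⊆))) (class-saturated j))))
        where
        class-saturated : ∀ j → Saturated cp (part (coarsen Q) j ∩ B)
        class-saturated j cpx≡cpw x∈ =
          let w∈B = B-saturated cpx≡cpw (∈-∩⁻ʳ x∈) in
          ∈-∩⁺ (∈-part⁺ (≡.trans (coarsen-coarser Q w∈B (∈-∩⁻ʳ x∈) (≡.sym cpx≡cpw)) (∈-part⁻ (∈-∩⁻ˡ x∈)))) w∈B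

    l≤componentValue : ∀ B → Saturated cp B → l B ≤ V B cp
    l≤componentValue = WellFounded.All.wfRec ⊂-wellFounded _ (λ B → Saturated cp B → l B ≤ V B cp) step
      where
      step : ∀ B → (∀ {D} → D ⊂ B → Saturated cp D → l D ≤ V D cp) → Saturated cp B → l B ≤ V B cp
      step B smaller B-saturated with total (l B) (V B cp)
      ... | inj₁ l≤V = l≤V
      ... | inj₂ V≤l with nonempty? B
      ...   | no  B=∅ = ≤-reflexive (trans (l-empty B=∅) (sym (partValue-empty cp B=∅)))
      ...   | yes (u , u∈B) =
        ≤-reflexive (sym (partValue-const (cp u) (λ x∈ → ∈-part⁻ (≡.subst (_ ∈_) B≡component x∈))))
        where
        B-connected : PartitionConnected R G l B
        B-connected = partitionConnected-from-≤ (λ Q →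
          [ id , (λ Q≤V → ≤-trans Q≤V V≤l) ]′ (partValue-≤-whole-or-components B-saturated smaller Q))
        B≡component : B ≡ part cp (cp u)
        B≡component = proj₂ (cp-components (cp u) (u , ∈-part⁺ ≡.refl)) B
                        (λ x∈ → B-saturated (≡.sym (∈-part⁻ x∈)) u∈B) B-connected

    componentValue-maximal : ∀ q → V ⊤ q ≤ V ⊤ cp
    componentValue-maximal q =
      [ (λ q≤l → ≤-trans q≤l (l≤componentValue ⊤ ⊤-saturated)) , id ]′
        (partValue-≤-whole-or-components ⊤-saturated (λ {D} _ → l≤componentValue D) q)
      where
      ⊤-saturated : Saturated cp ⊤
      ⊤-saturated _ _ = ∈⊤

mainTheorem4 : ∀ {c ℓ₁ ℓ₂ : Level} (R : OrderedCommutativeRing c ℓ₁ ℓ₂) →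
    let open OrderedCommutativeRing R in
    ∀ (n : ℕ) (G : Graph n) (l : Subset n → Carrier) →
    l ⊥ ≈ 0# →
    IntersectingSupermodular R l →
    ∀ (t : Carrier) → IsTheta R G l t → IsMaxPartValue R G l t
mainTheorem4 R n G l l∅ sup t (cp , cp-components , t≈Θ) =
  (cp , t≈Θ) , λ q → ≤-respʳ-≈ (sym t≈Θ) (componentValue-maximal q)
  where
  open OrderedCommutativeRing R
  open OrderedCommutativeRingProperties R
  open ComponentPartition R G l l∅ sup cp cp-components
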